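{- For infinitely many $n$ there exists an instance of LogBgt-Path of size $n$ such that the integrality gap of LP-LBO-Path is $\Omega(\log n)$. Thus the natural linear programming relaxations of both LogBgt-Path (LP-LBO-Path) and LogBgt-PerMat (LP-LBO-PM) have integrality gaps $\Omega(\log n)$.
   Context: For a ground set of size $n$, $T=\lceil\log_2 n\rceil$. LogBgt-Path instance: directed graph $(V,E)$, vertices $s,t$, ground set $E$ with $n=|E|$, pairwise disjoint $S_1,\dots,S_T\subseteq E$. LP-LBO-Path: minimize $z$ subject to $\sum_{j:(i,j)\in E}x_{i,j}-\sum_{j:(j,i)\in E}x_{j,i}=0$ for all $i\in V\setminus\{s,t\}$; $\sum_{j:(s,j)\in E}x_{s,j}=1$; $\sum_{i:(i,t)\in E}x_{i,t}=1$; $\sum_{e\in S_i}x_e\le z\cdot2^i$ for $1\le i\le T$; $0\le x_e\le1$. LogBgt-PerMat instance: bipartite graph $(L,R,E)$, $|L|=|R|$, ground set $E$, disjoint $S_1,\dots,S_T\subseteq E$. LP-LBO-PM: minimize $z$ subject to $\sum_{i:(i,j)\in E}x_{i,j}=1$ for all $j\in R$, $\sum_{j:(i,j)\in E}x_{i,j}=1$ for all $i\in L$, $\sum_{e\in S_i}x_e\le z2^i$ for all $i$, $0\le x\le1$. The integrality gap is the ratio of the optimum over integral $x$ to the optimum over fractional $x$. -}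

module Defs where

open import Data.Nat as ℕ using (ℕ; zero; suc; _^_)
open import Data.Nat.Logarithm using (⌈log₂_⌉; ⌊log₂_⌋)
open import Data.Fin as Fin using (Fin; toℕ)
open import Data.Bool using (Bool; true; false; if_then_else_)
open import Data.Maybe using (Maybe; just; nothing)
open import Data.Product using (_×_; Σ; ∃; _,_)
open import Data.Sum using (_⊎_)
open import Data.Integer using (+_)
open import Data.Rational using (ℚ; 0ℚ; 1ℚ; _+_; _*_; _≤_; _<_; _/_)
open import Relation.Nullary using (¬_; does)
open import Relation.Binary.PropositionalEquality using (_≡_; _≢_)
open import Function.Definitions using (Injective)

T : ℕ → ℕ
T n = ⌈log₂ n ⌉

ℕ→ℚ : ℕ → ℚ
ℕ→ℚ k = + k / 1

Σℚ : ∀ {n} → (Fin n → ℚ) → ℚ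
Σℚ {zero}  f = 0ℚ
Σℚ {suc n} f = f Fin.zero + Σℚ (λ i → f (Fin.suc i))

ΣWhere : ∀ {n} → (Fin n → Bool) → (Fin n → ℚ) → ℚ
ΣWhere p f = Σℚ (λ e → if p e then f e else 0ℚ)

_==_ : ∀ {m} → Fin m → Fin m → Bool
a == b = does (a Fin.≟ b)

inSet : ∀ {T} → Maybe (Fin T) → Fin T → Bool
inSet nothing  k = false
inSet (just j) k = j == k

Integral : ∀ {n} → (Fin n → ℚ) → Set
Integral x = ∀ e → (x e ≡ 0ℚ) ⊎ (x e ≡ 1ℚ)

-- S e = just k means e ∈ S_{k+1} (k : Fin T, so the
-- sets S_1..S_T are pairwise disjoint by construction); nothing means
-- e lies in no S_i.

record PathInstance (n : ℕ) : Set where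
  field
    nV       : ℕ
    src tgt  : Fin n → Fin nV
    s t      : Fin nV
    s≢t      : s ≢ t
    loopless : ∀ e → src e ≢ tgt e
    simple   : ∀ e e' → src e ≡ src e' → tgt e ≡ tgt e' → e ≡ e'
    S        : Fin n → Maybe (Fin (T n))

PathFeasible : ∀ {n} → PathInstance n → (Fin n → ℚ) → ℚ → Set
PathFeasible {n} I x z =
    (∀ e → (0ℚ ≤ x e) × (x e ≤ 1ℚ))
  × (∀ i → i ≢ s → i ≢ t →
       ΣWhere (λ e → src e == i) x ≡ ΣWhere (λ e → tgt e == i) x)
  × (ΣWhere (λ e → src e == s) x ≡ 1ℚ)
  × (ΣWhere (λ e → tgt e == t) x ≡ 1ℚ)
  × (∀ (k : Fin (T n)) →
       ΣWhere (λ e → inSet (S e) k) x ≤ z * ℕ→ℚ (2 ^ suc (toℕ k)))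
  where open PathInstance I

record PMInstance (n : ℕ) : Set where
  field
    m           : ℕ
    left right  : Fin n → Fin m
    simple      : ∀ e e' → left e ≡ left e' → right e ≡ right e' → e ≡ e'
    S           : Fin n → Maybe (Fin (T n))

PMFeasible : ∀ {n} → PMInstance n → (Fin n → ℚ) → ℚ → Set
PMFeasible {n} I x z =
    (∀ e → (0ℚ ≤ x e) × (x e ≤ 1ℚ))
  × (∀ j → ΣWhere (λ e → right e == j) x ≡ 1ℚ)
  × (∀ i → ΣWhere (λ e → left e == i) x ≡ 1ℚ)
  × (∀ (k : Fin (T n)) →
       ΣWhere (λ e → inSet (S e) k) x ≤ z * ℕ→ℚ (2 ^ suc (toℕ k)))
  where open PMInstance I

-- Integrality gap of an LP (given by its feasibility predicate) is at
-- least g: there is a fractional feasible (xf , zf) with zf > 0 such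
-- that every integral feasible (x , z) has z ≥ g · zf.
-- (Equivalent to OPT_int / OPT_frac ≥ g, since the LP optimum is
-- attained at a rational point.)
GapAtLeast : ∀ {n} → ((Fin n → ℚ) → ℚ → Set) → ℚ → Set
GapAtLeast {n} Feas g =
  Σ (Fin n → ℚ) λ xf → Σ ℚ λ zf →
    Feas xf zf × (0ℚ < zf) ×
    (∀ (x : Fin n → ℚ) (z : ℚ) → Integral x → Feas x z → g * zf ≤ z)

{-# OPTIONS --safe #-}
module Submission where

-- Take k s–t paths with 2^k + 2 edges each, disjoint apart from s and t, and
-- let the first 2^(j+1) edges of the j-th path form its share of S_(j+1).
-- The flow 1/k on every edge is feasible with z = 1/k, since S_(j+1) then
-- carries 2^(j+1)/k. An integral unit flow, by conservation at the inner
-- vertices, uses some path entirely; that path fills S_(j+1) with 2^(j+1)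
-- edges, so z ≥ 1, and the gap is at least k ≥ ¼⌊log₂ n⌋ as n ≤ 2^(4k).
-- For perfect matchings, split every inner vertex into a left and a right
-- copy joined by an idle edge: the degree constraints at the two copies force
-- equal flow into and out of the vertex, so the same argument applies, and
-- the fractional point puts 1 − 1/k on the idle edges.

open import Defs
open import Data.Nat as ℕ using (ℕ)

module RationalFacts where
  import Data.Nat.Properties as ℕ
  open import Data.Nat.Coprimality using (1-coprimeTo) renaming (sym to coprime-sym)
  open import Data.Integer using (+_)
  import Data.Integer.Properties as ℤ
  open import Data.Product using (_,_)
  open import Data.Rational
  open import Data.Rational.Properties
  open import Data.Rational.Solver using (module +-*-Solver)
  open import Relation.Binary.PropositionalEquality

  ℕ→ℚ≡mkℚ : ∀ m → ℕ→ℚ m ≡ mkℚ (+ m) 0 (coprime-sym (1-coprimeTo m))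
  ℕ→ℚ≡mkℚ m = normalize-coprime (coprime-sym (1-coprimeTo m))

  ℕ→ℚ-+ : ∀ m n → ℕ→ℚ (m ℕ.+ n) ≡ ℕ→ℚ m + ℕ→ℚ n
  ℕ→ℚ-+ m n
    rewrite ℕ→ℚ≡mkℚ m | ℕ→ℚ≡mkℚ n | ℤ.*-identityʳ (+ m) | ℤ.*-identityʳ (+ n) = refl

  ℕ→ℚ-* : ∀ m n → ℕ→ℚ (m ℕ.* n) ≡ ℕ→ℚ m * ℕ→ℚ n
  ℕ→ℚ-* m n rewrite ℕ→ℚ≡mkℚ m | ℕ→ℚ≡mkℚ n | sym (ℤ.pos-* m n) = refl

  ℕ→ℚ-nonNeg : ∀ m → 0ℚ ≤ ℕ→ℚ m
  ℕ→ℚ-nonNeg m = nonNegative⁻¹ (ℕ→ℚ m) {{normalize-nonNeg m 1}}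

  ℕ→ℚ-positive : ∀ m .{{_ : ℕ.NonZero m}} → Positive (ℕ→ℚ m)
  ℕ→ℚ-positive m = normalize-pos m 1

  ℕ→ℚ-mono-≤ : ∀ {m n} → m ℕ.≤ n → ℕ→ℚ m ≤ ℕ→ℚ n
  ℕ→ℚ-mono-≤ {m} m≤n with d , refl ← ℕ.m≤n⇒∃[o]m+o≡n m≤n = begin
    ℕ→ℚ m           ≡⟨ +-identityʳ (ℕ→ℚ m) ⟨
    ℕ→ℚ m + 0ℚ      ≤⟨ +-monoʳ-≤ (ℕ→ℚ m) (ℕ→ℚ-nonNeg d) ⟩
    ℕ→ℚ m + ℕ→ℚ d   ≡⟨ ℕ→ℚ-+ m d ⟨
    ℕ→ℚ (m ℕ.+ d)   ∎
    where open ≤-Reasoning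

  ℕ→ℚ-suc-* : ∀ m p → ℕ→ℚ (ℕ.suc m) * p ≡ p + ℕ→ℚ m * p
  ℕ→ℚ-suc-* m p = begin
    ℕ→ℚ (ℕ.suc m) * p     ≡⟨ cong (_* p) (ℕ→ℚ-+ 1 m) ⟩
    (1ℚ + ℕ→ℚ m) * p      ≡⟨ *-distribʳ-+ p 1ℚ (ℕ→ℚ m) ⟩
    1ℚ * p + ℕ→ℚ m * p    ≡⟨ cong (_+ ℕ→ℚ m * p) (*-identityˡ p) ⟩
    p + ℕ→ℚ m * p         ∎
    where open ≡-Reasoning

  p+[1-p]≡1 : ∀ p → p + (1ℚ - p) ≡ 1ℚ
  p+[1-p]≡1 = solve 1 (λ p → p :+ (con 1ℚ :- p) := con 1ℚ) refl
    where open +-*-Solver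

  0≤1-p : ∀ {p} → p ≤ 1ℚ → 0ℚ ≤ 1ℚ - p
  0≤1-p {p} p≤1 = begin
    0ℚ      ≡⟨ +-inverseʳ p ⟨
    p - p   ≤⟨ +-monoˡ-≤ (- p) p≤1 ⟩
    1ℚ - p  ∎
    where open ≤-Reasoning

  1-p≤1 : ∀ {p} → 0ℚ ≤ p → 1ℚ - p ≤ 1ℚ
  1-p≤1 0≤p = ≤-trans (+-monoʳ-≤ 1ℚ (neg-antimono-≤ 0≤p)) (≤-reflexive (+-identityʳ 1ℚ))

  ¼ : ℚ
  ¼ = + 1 / 4

  0<¼ : 0ℚ < ¼
  0<¼ = positive⁻¹ ¼

  ¼*-≤ : ∀ {l n} → l ℕ.≤ 4 ℕ.* n → ¼ * ℕ→ℚ l ≤ ℕ→ℚ n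
  ¼*-≤ {l} {n} l≤4n = begin
    ¼ * ℕ→ℚ l               ≤⟨ *-monoˡ-≤-nonNeg ¼ (ℕ→ℚ-mono-≤ l≤4n) ⟩
    ¼ * ℕ→ℚ (4 ℕ.* n)       ≡⟨ cong (¼ *_) (ℕ→ℚ-* 4 n) ⟩
    ¼ * (ℕ→ℚ 4 * ℕ→ℚ n)     ≡⟨ *-assoc ¼ (ℕ→ℚ 4) (ℕ→ℚ n) ⟨
    1ℚ * ℕ→ℚ n              ≡⟨ *-identityˡ (ℕ→ℚ n) ⟩
    ℕ→ℚ n                   ∎
    where open ≤-Reasoning

module FinFacts where
  open import Data.Nat using (zero; suc)
  open import Data.Bool using (true; false)
  open import Data.Fin using (Fin; zero; suc; _≟_; fromℕ; inject₁)
  open import Data.Maybe as Maybe using (Maybe; just; nothing)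
  open import Function.Definitions using (Injective)
  open import Relation.Binary.PropositionalEquality
  open import Relation.Nullary using (yes)
  open import Relation.Nullary.Decidable using (dec-true; dec-false)

  ==⇒≡ : ∀ {m} {a b : Fin m} → (a == b) ≡ true → a ≡ b
  ==⇒≡ {a = a} {b} a==b with a ≟ b
  ... | yes a≡b = a≡b

  ==-refl : ∀ {m} (a : Fin m) → (a == a) ≡ true
  ==-refl a = dec-true (a ≟ a) refl

  ≢⇒==-false : ∀ {m} {a b : Fin m} → a ≢ b → (a == b) ≡ false
  ≢⇒==-false {a = a} {b} = dec-false (a ≟ b)

  module _ {A : Set} {m} {f : A → Fin m} (f-injective : Injective _≡_ _≡_ f) where

    ==-injective : ∀ {a b} → (f a == f b) ≡ true → a ≡ b
    ==-injective fa==fb = f-injective (==⇒≡ fa==fb)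

    ==-injective-false : ∀ {a b} → a ≢ b → (f a == f b) ≡ false
    ==-injective-false a≢b = ≢⇒==-false (λ fa≡fb → a≢b (f-injective fa≡fb))

  lower₁? : ∀ {l} → Fin (suc l) → Maybe (Fin l)
  lower₁? {zero}  zero    = nothing
  lower₁? {suc l} zero    = just zero
  lower₁? {suc l} (suc p) = Maybe.map suc (lower₁? p)

  lower₁?-fromℕ : ∀ l → lower₁? (fromℕ l) ≡ nothing
  lower₁?-fromℕ zero    = refl
  lower₁?-fromℕ (suc l) = cong (Maybe.map suc) (lower₁?-fromℕ l)

  lower₁?-inject₁ : ∀ {l} (q : Fin l) → lower₁? (inject₁ q) ≡ just q
  lower₁?-inject₁ {suc l} zero    = refl
  lower₁?-inject₁ {suc l} (suc q) = cong (Maybe.map suc) (lower₁?-inject₁ q)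

  lower₁?≡just⇒ : ∀ {l} (p : Fin (suc l)) {q} → lower₁? p ≡ just q → p ≡ inject₁ q
  lower₁?≡just⇒ {suc l} zero    refl = refl
  lower₁?≡just⇒ {suc l} (suc p) eq with lower₁? p in eq′
  lower₁?≡just⇒ {suc l} (suc p) refl | just q = cong suc (lower₁?≡just⇒ p eq′)

  lower₁?≡nothing⇒ : ∀ {l} (p : Fin (suc l)) → lower₁? p ≡ nothing → p ≡ fromℕ l
  lower₁?≡nothing⇒ {zero}  zero    _  = refl
  lower₁?≡nothing⇒ {suc l} (suc p) eq with lower₁? p in eq′
  ... | nothing = cong suc (lower₁?≡nothing⇒ p eq′)

module FiniteSums where
  open RationalFacts
  import Data.Nat.Properties as ℕ
  open import Data.Nat using (zero; suc)
  open import Data.Bool using (Bool; true; false; if_then_else_)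
  open import Data.Fin as Fin using (Fin; zero; suc; toℕ; combine; remQuot; splitAt; _↑ˡ_; _↑ʳ_)
  import Data.Fin.Properties as Fin
  open import Data.Product using (∃; _×_; _,_; uncurry)
  open import Data.Sum using (_⊎_; inj₁; inj₂)
  open import Function using (_∘_)
  open import Data.Rational using (ℚ; 0ℚ; _+_; _*_)
  open import Data.Rational.Properties
  open import Relation.Binary.PropositionalEquality
  open import Relation.Nullary using (yes; no; contradiction)

  Σℚ-cong : ∀ {n} {f g : Fin n → ℚ} → (∀ i → f i ≡ g i) → Σℚ f ≡ Σℚ g
  Σℚ-cong {zero}  f≗g = refl
  Σℚ-cong {suc n} f≗g = cong₂ _+_ (f≗g zero) (Σℚ-cong (f≗g ∘ suc))

  Σℚ-zero : ∀ {n} {f : Fin n → ℚ} → (∀ i → f i ≡ 0ℚ) → Σℚ f ≡ 0ℚ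
  Σℚ-zero {zero}  f≗0 = refl
  Σℚ-zero {suc n} f≗0 = trans (cong₂ _+_ (f≗0 zero) (Σℚ-zero (f≗0 ∘ suc))) (+-identityˡ 0ℚ)

  Σℚ-const : ∀ n y → Σℚ {n} (λ _ → y) ≡ ℕ→ℚ n * y
  Σℚ-const zero    y = sym (*-zeroˡ y)
  Σℚ-const (suc n) y = trans (cong (y +_) (Σℚ-const n y)) (sym (ℕ→ℚ-suc-* n y))

  Σℚ-prefix : ∀ {n} c y → c ℕ.≤ n →
    Σℚ {n} (λ i → if toℕ i ℕ.<ᵇ c then y else 0ℚ) ≡ ℕ→ℚ c * y
  Σℚ-prefix {n}     zero    y _ = trans (Σℚ-zero {n} (λ _ → refl)) (sym (*-zeroˡ y))
  Σℚ-prefix {suc n} (suc c) y (ℕ.s≤s c≤n) =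
    trans (cong (y +_) (Σℚ-prefix c y c≤n)) (sym (ℕ→ℚ-suc-* c y))

  Σℚ-++ : ∀ m n (f : Fin (m ℕ.+ n) → ℚ) →
    Σℚ f ≡ Σℚ (λ i → f (i ↑ˡ n)) + Σℚ (λ j → f (m ↑ʳ j))
  Σℚ-++ zero    n f = sym (+-identityˡ _)
  Σℚ-++ (suc m) n f = trans (cong (f zero +_) (Σℚ-++ m n (f ∘ suc))) (sym (+-assoc (f zero) _ _))

  Σℚ-combine : ∀ m n (f : Fin (m ℕ.* n) → ℚ) →
    Σℚ f ≡ Σℚ (λ (i : Fin m) → Σℚ (λ (j : Fin n) → f (combine i j)))
  Σℚ-combine zero    n f = refl
  Σℚ-combine (suc m) n f =
    trans (Σℚ-++ n (m ℕ.* n) f)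
          (cong (Σℚ (λ j → f (j ↑ˡ m ℕ.* n)) +_) (Σℚ-combine m n (f ∘ (n ↑ʳ_))))

  Σℚ-unique : ∀ {n} {f : Fin n → ℚ} (a : Fin n) → (∀ i → i ≢ a → f i ≡ 0ℚ) → Σℚ f ≡ f a
  Σℚ-unique {suc n} {f} zero others≡0 =
    trans (cong (f zero +_) (Σℚ-zero (λ i → others≡0 (suc i) λ ()))) (+-identityʳ (f zero))
  Σℚ-unique {suc n} {f} (suc a) others≡0 =
    trans (cong₂ _+_ (others≡0 zero λ ())
                     (Σℚ-unique a λ i i≢a → others≡0 (suc i) (i≢a ∘ Fin.suc-injective)))
          (+-identityˡ (f (suc a)))

  Σℚ≢0⇒∃≢0 : ∀ {n} (f : Fin n → ℚ) → Σℚ f ≢ 0ℚ → ∃ λ i → f i ≢ 0ℚ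
  Σℚ≢0⇒∃≢0 {zero}  f Σf≢0 = contradiction refl Σf≢0
  Σℚ≢0⇒∃≢0 {suc n} f Σf≢0 with f zero ≟ 0ℚ
  ... | no  f0≢0 = zero , f0≢0
  ... | yes f0≡0
    with i , fi≢0 ← Σℚ≢0⇒∃≢0 (f ∘ suc) (λ Σ≡0 → Σf≢0 (cong₂ _+_ f0≡0 Σ≡0)) = suc i , fi≢0

  ΣWhere-false : ∀ {n} (P : Fin n → Bool) (x : Fin n → ℚ) → (∀ e → P e ≡ false) → ΣWhere P x ≡ 0ℚ
  ΣWhere-false P x ¬P = Σℚ-zero (λ e → cong (λ b → if b then x e else 0ℚ) (¬P e))

  ΣWhere-true : ∀ {n} (P : Fin n → Bool) (x : Fin n → ℚ) → (∀ e → P e ≡ true) → ΣWhere P x ≡ Σℚ x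
  ΣWhere-true P x allP = Σℚ-cong (λ e → cong (λ b → if b then x e else 0ℚ) (allP e))

  ΣWhere-atMostOne : ∀ {n} (P : Fin n → Bool) (x : Fin n → ℚ) (a : Fin n) →
    (∀ e → P e ≡ true → e ≡ a) → ΣWhere P x ≡ (if P a then x a else 0ℚ)
  ΣWhere-atMostOne P x a P⇒≡a = Σℚ-unique a others≡0
    where
    others≡0 : ∀ e → e ≢ a → (if P e then x e else 0ℚ) ≡ 0ℚ
    others≡0 e e≢a with P e in Pe
    ... | true  = contradiction (P⇒≡a e Pe) e≢a
    ... | false = refl

  ΣWhere-unique : ∀ {n} (P : Fin n → Bool) (x : Fin n → ℚ) (a : Fin n) →
    (∀ e → P e ≡ true → e ≡ a) → P a ≡ true → ΣWhere P x ≡ x a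
  ΣWhere-unique P x a P⇒≡a Pa = trans (ΣWhere-atMostOne P x a P⇒≡a) (cong (λ b → if b then x a else 0ℚ) Pa)

  ΣWhere-splitAt : ∀ m n (P : Fin m ⊎ Fin n → Bool) (x : Fin (m ℕ.+ n) → ℚ) →
    ΣWhere (P ∘ splitAt m) x ≡ ΣWhere (P ∘ inj₁) (x ∘ (_↑ˡ n)) + ΣWhere (P ∘ inj₂) (x ∘ (m ↑ʳ_))
  ΣWhere-splitAt m n P x = trans (Σℚ-++ m n _) (cong₂ _+_
    (Σℚ-cong (λ i → cong (λ b → if P b then x (i ↑ˡ n) else 0ℚ) (Fin.splitAt-↑ˡ m i n)))
    (Σℚ-cong (λ j → cong (λ b → if P b then x (m ↑ʳ j) else 0ℚ) (Fin.splitAt-↑ʳ m n j))))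

  ΣWhere-remQuot : ∀ m n (Q : Fin m → Fin n → Bool) (x : Fin (m ℕ.* n) → ℚ) →
    ΣWhere (uncurry Q ∘ remQuot n) x ≡ Σℚ (λ (i : Fin m) → ΣWhere (Q i) (x ∘ combine i))
  ΣWhere-remQuot m n Q x = trans (Σℚ-combine m n _) (Σℚ-cong λ i → Σℚ-cong λ j →
    cong (λ b → if uncurry Q b then x (combine i j) else 0ℚ) (Fin.remQuot-combine i j))

  ΣWhere-remQuot-unique : ∀ {m} n (Q : Fin m → Fin n → Bool) (x : Fin (m ℕ.* n) → ℚ) a b →
    (∀ i j → Q i j ≡ true → i ≡ a × j ≡ b) → Q a b ≡ true →
    ΣWhere (uncurry Q ∘ remQuot n) x ≡ x (combine a b)
  ΣWhere-remQuot-unique {m} n Q x a b Q⇒≡ab Qab =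
    ΣWhere-unique (uncurry Q ∘ remQuot n) x (combine a b) Q⇒≡
      (trans (cong (uncurry Q) (Fin.remQuot-combine a b)) Qab)
    where
    Q⇒≡ : ∀ e → uncurry Q (remQuot n e) ≡ true → e ≡ combine a b
    Q⇒≡ e Qe with i≡a , j≡b ← Q⇒≡ab _ _ Qe =
      trans (sym (Fin.combine-remQuot {m} n e)) (cong₂ combine i≡a j≡b)

module IntegralityGap where
  open import Data.Fin using (Fin)
  open import Data.Product using (_,_)
  open import Data.Rational using (ℚ; _≤_; nonNegative)
  open import Data.Rational.Properties using (≤-trans; <⇒≤; *-monoʳ-≤-nonNeg)

  GapAtLeast-mono : ∀ {n} {Feas : (Fin n → ℚ) → ℚ → Set} {g h} →
    g ≤ h → GapAtLeast Feas h → GapAtLeast Feas g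
  GapAtLeast-mono g≤h (xf , zf , feasible , 0<zf , bound) =
    xf , zf , feasible , 0<zf , λ x z integral feasible-x →
      ≤-trans (*-monoʳ-≤-nonNeg zf {{nonNegative (<⇒≤ 0<zf)}} g≤h) (bound x z integral feasible-x)

module ParallelPaths (k m : ℕ) .{{_ : ℕ.NonZero k}} where
  open RationalFacts
  open FinFacts
  open FiniteSums
  open import Data.Nat using (zero; suc; _^_; _<ᵇ_)
  import Data.Nat.Properties as ℕ
  open import Data.Bool using (true; false; if_then_else_)
  open import Data.Bool.Properties using (¬-not)
  open import Data.Fin as Fin
    using (Fin; zero; suc; toℕ; fromℕ; inject₁; inject≤; combine; remQuot; splitAt; _↑ˡ_; _↑ʳ_)
  import Data.Fin.Properties as Fin
  open import Data.Fin.Induction using (<-weakInduction)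
  open import Data.Maybe as Maybe using (Maybe; just; nothing)
  open import Data.Maybe.Properties using (just-injective)
  open import Data.Product using (∃; _×_; _,_; proj₁; proj₂; uncurry)
  open import Data.Sum using (inj₁; inj₂; [_,_]′)
  open import Function using (_∘_; const)
  open import Function.Definitions using (Injective)
  open import Data.Rational as ℚ using (ℚ; 0ℚ; 1ℚ; _+_; _*_; _≤_; _<_; 1/_; Positive)
  open import Data.Rational.Properties
  open import Relation.Binary.PropositionalEquality
  open import Relation.Nullary using (yes; no; contradiction)
  open import Algebra.Properties.Group +-0-group using (∙-cancelʳ)

  -- k paths from s to t with len edges each: edge p j is the p-th edge of
  -- path j and inner q j its vertex between edges q and q + 1; as an
  -- endpoint, nothing stands for s (as a tail) and for t (as a head).
  len : ℕ
  len = suc (suc m)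

  W : ℕ
  W = suc m ℕ.* k

  n : ℕ
  n = len ℕ.* k

  last : Fin len
  last = fromℕ (suc m)

  edge : Fin len → Fin k → Fin n
  edge = combine

  inner : Fin (suc m) → Fin k → Fin W
  inner = combine

  inner-elim : {P : Fin W → Set} → (∀ q j → P (inner q j)) → ∀ w → P w
  inner-elim {P} P-inner w =
    subst P (Fin.combine-remQuot {suc m} k w) (P-inner (proj₁ (remQuot k w)) (proj₂ (remQuot k w)))

  tail′ : Fin len → Fin k → Maybe (Fin W)
  tail′ zero    j = nothing
  tail′ (suc q) j = just (inner q j)

  head′ : Fin len → Fin k → Maybe (Fin W)
  head′ p j = Maybe.map (λ q → inner q j) (lower₁? p)

  tail head : Fin n → Maybe (Fin W)
  tail = uncurry tail′ ∘ remQuot k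
  head = uncurry head′ ∘ remQuot k

  tail′≡just⇒ : ∀ p j q j₀ → tail′ p j ≡ just (inner q j₀) → p ≡ suc q × j ≡ j₀
  tail′≡just⇒ (suc q′) j q j₀ eq with refl , refl ← Fin.combine-injective q′ j q j₀ (just-injective eq) =
    refl , refl

  head′≡just⇒ : ∀ p j q j₀ → head′ p j ≡ just (inner q j₀) → p ≡ inject₁ q × j ≡ j₀
  head′≡just⇒ p j q j₀ eq with lower₁? p in eq′
  ... | just q′ with refl , refl ← Fin.combine-injective q′ j q j₀ (just-injective eq) =
    lower₁?≡just⇒ p eq′ , refl

  head′≡nothing⇒ : ∀ p j → head′ p j ≡ nothing → p ≡ last
  head′≡nothing⇒ p j eq with lower₁? p in eq′
  ... | nothing = lower₁?≡nothing⇒ p eq′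

  head′-last : ∀ j → head′ last j ≡ nothing
  head′-last j = cong (Maybe.map (λ q → inner q j)) (lower₁?-fromℕ (suc m))

  head′-inject₁ : ∀ q j → head′ (inject₁ q) j ≡ just (inner q j)
  head′-inject₁ q j = cong (Maybe.map (λ q → inner q j)) (lower₁?-inject₁ q)

  no-loop : ∀ e w → tail e ≡ just w → head e ≢ just w
  no-loop e = no-loop′ (proj₁ (remQuot k e)) (proj₂ (remQuot k e))
    where
    no-loop′ : ∀ p j w → tail′ p j ≡ just w → head′ p j ≢ just w
    no-loop′ (suc q) j w refl h with suc≡inject₁ , _ ← head′≡just⇒ (suc q) j q j h =
      ℕ.1+n≢n (trans (cong toℕ suc≡inject₁) (Fin.toℕ-inject₁ q))

  endpoints-injective : ∀ e e′ → tail e ≡ tail e′ → head e ≡ head e′ → e ≡ e′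
  endpoints-injective e e′ t≡ h≡ = begin
    e                            ≡⟨ Fin.combine-remQuot {len} k e ⟨
    uncurry combine (remQuot k e)   ≡⟨ cong (uncurry combine) (positions-injective _ _ t≡ h≡) ⟩
    uncurry combine (remQuot k e′)  ≡⟨ Fin.combine-remQuot {len} k e′ ⟩
    e′                           ∎
    where
    open ≡-Reasoning
    positions-injective : ∀ (r r′ : Fin len × Fin k) →
      uncurry tail′ r ≡ uncurry tail′ r′ → uncurry head′ r ≡ uncurry head′ r′ → r ≡ r′
    positions-injective (zero , j) (zero , j′) _ h
      with refl ← Fin.combine-injectiveʳ (zero {m}) j zero j′ (just-injective h) = refl
    positions-injective (suc q , j) (suc q′ , j′) t _
      with refl , refl ← Fin.combine-injective q j q′ j′ (just-injective t) = refl

  module Flow {V : ℕ} {vertex : Maybe (Fin W) → Fin V} (vertex-injective : Injective _≡_ _≡_ vertex) where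

    outflow-s : ∀ x → ΣWhere (λ e → vertex (tail e) == vertex nothing) x ≡ Σℚ (x ∘ edge zero)
    outflow-s x = begin
      ΣWhere (λ e → vertex (tail e) == vertex nothing) x
        ≡⟨ ΣWhere-remQuot len k (λ p j → vertex (tail′ p j) == vertex nothing) x ⟩
      ΣWhere (λ _ → vertex nothing == vertex nothing) (x ∘ edge zero)
        + Σℚ (λ (q : Fin (suc m)) →
            ΣWhere (λ j → vertex (just (inner q j)) == vertex nothing) (x ∘ edge (suc q)))
        ≡⟨ cong₂ _+_ (ΣWhere-true _ (x ∘ edge zero) (λ _ → ==-refl (vertex nothing)))
                     (Σℚ-zero (λ q → ΣWhere-false _ (x ∘ edge (suc q)) (λ j →
                        ==-injective-false vertex-injective {just (inner q j)} {nothing} λ ()))) ⟩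
      Σℚ (x ∘ edge zero) + 0ℚ
        ≡⟨ +-identityʳ _ ⟩
      Σℚ (x ∘ edge zero) ∎
      where open ≡-Reasoning

    inflow-t : ∀ x → ΣWhere (λ e → vertex (head e) == vertex nothing) x ≡ Σℚ (x ∘ edge last)
    inflow-t x = begin
      ΣWhere (λ e → vertex (head e) == vertex nothing) x
        ≡⟨ ΣWhere-remQuot len k (λ p j → vertex (head′ p j) == vertex nothing) x ⟩
      Σℚ (λ (p : Fin len) → ΣWhere (λ j → vertex (head′ p j) == vertex nothing) (x ∘ edge p))
        ≡⟨ Σℚ-unique last (λ p p≢last → ΣWhere-false _ (x ∘ edge p) λ j →
             ==-injective-false vertex-injective (p≢last ∘ head′≡nothing⇒ p j)) ⟩
      ΣWhere (λ j → vertex (head′ last j) == vertex nothing) (x ∘ edge last)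
        ≡⟨ ΣWhere-true _ (x ∘ edge last) (λ j →
             trans (cong (λ a → vertex a == vertex nothing) (head′-last j)) (==-refl (vertex nothing))) ⟩
      Σℚ (x ∘ edge last) ∎
      where open ≡-Reasoning

    outflow-inner : ∀ x q j → ΣWhere (λ e → vertex (tail e) == vertex (just (inner q j))) x ≡ x (edge (suc q) j)
    outflow-inner x q j =
      ΣWhere-remQuot-unique k (λ p j′ → vertex (tail′ p j′) == vertex (just (inner q j))) x (suc q) j
        (λ p j′ → tail′≡just⇒ p j′ q j ∘ ==-injective vertex-injective) (==-refl (vertex (just (inner q j))))

    inflow-inner : ∀ x q j → ΣWhere (λ e → vertex (head e) == vertex (just (inner q j))) x ≡ x (edge (inject₁ q) j)
    inflow-inner x q j =
      ΣWhere-remQuot-unique k (λ p j′ → vertex (head′ p j′) == vertex (just (inner q j))) x (inject₁ q) j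
        (λ p j′ → head′≡just⇒ p j′ q j ∘ ==-injective vertex-injective)
        (trans (cong (λ a → vertex a == vertex (just (inner q j))) (head′-inject₁ q j))
               (==-refl (vertex (just (inner q j)))))

  integral-flow-saturates-path : ∀ x → Integral x → Σℚ (x ∘ edge zero) ≡ 1ℚ →
    (∀ q j → x (edge (suc q) j) ≡ x (edge (inject₁ q) j)) →
    ∃ λ j → ∀ p → x (edge p j) ≡ 1ℚ
  integral-flow-saturates-path x integral Σ≡1 conserved
    with j , x≢0 ← Σℚ≢0⇒∃≢0 (x ∘ edge zero) (λ Σ≡0 → 1≢0 (trans (sym Σ≡1) Σ≡0)) =
    j , <-weakInduction (λ p → x (edge p j) ≡ 1ℚ) first-edge (λ q x≡1 → trans (conserved q j) x≡1)
    where
    first-edge : x (edge zero j) ≡ 1ℚ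
    first-edge with integral (edge zero j)
    ... | inj₁ x≡0 = contradiction x≡0 x≢0
    ... | inj₂ x≡1 = x≡1

  module Labelling {Tn : ℕ} (k≤Tn : k ℕ.≤ Tn) (2^k≤len : 2 ^ k ℕ.≤ len) where

    ι : Fin k → Fin Tn
    ι j = inject≤ j k≤Tn

    budget : Fin Tn → ℕ
    budget t = 2 ^ suc (toℕ t)

    budget-positive : ∀ t → Positive (ℕ→ℚ (budget t))
    budget-positive t = ℕ→ℚ-positive (budget t) {{ℕ.m^n≢0 2 (suc (toℕ t))}}

    budget≤len : ∀ j → budget (ι j) ℕ.≤ len
    budget≤len j = ℕ.≤-trans (ℕ.^-monoʳ-≤ 2 toℕ[ιj]<k) 2^k≤len
      where
      toℕ[ιj]<k : toℕ (ι j) ℕ.< k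
      toℕ[ιj]<k = subst (ℕ._< k) (sym (Fin.toℕ-inject≤ j k≤Tn)) (Fin.toℕ<n j)

    label′ : Fin len → Fin k → Maybe (Fin Tn)
    label′ p j = if toℕ p <ᵇ budget (ι j) then just (ι j) else nothing

    label : Fin n → Maybe (Fin Tn)
    label = uncurry label′ ∘ remQuot k

    load : (Fin n → ℚ) → Fin Tn → ℚ
    load x t = ΣWhere (λ e → inSet (label e) t) x

    inSet-label′ : ∀ p j t → inSet (label′ p j) t ≡ true → ι j ≡ t
    inSet-label′ p j t h with toℕ p <ᵇ budget (ι j)
    ... | true = ==⇒≡ h

    inSet-label′-ι : ∀ p j (v : ℚ) →
      (if inSet (label′ p j) (ι j) then v else 0ℚ) ≡ (if toℕ p <ᵇ budget (ι j) then v else 0ℚ)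
    inSet-label′-ι p j v with toℕ p <ᵇ budget (ι j)
    ... | true  = cong (λ b → if b then v else 0ℚ) (==-refl (ι j))
    ... | false = refl

    load-ι : ∀ x y j → (∀ p → x (edge p j) ≡ y) → load x (ι j) ≡ ℕ→ℚ (budget (ι j)) * y
    load-ι x y j x≡y = begin
      load x (ι j)
        ≡⟨ ΣWhere-remQuot len k (λ p j′ → inSet (label′ p j′) (ι j)) x ⟩
      Σℚ (λ (p : Fin len) → ΣWhere (λ j′ → inSet (label′ p j′) (ι j)) (x ∘ edge p))
        ≡⟨ Σℚ-cong (λ p → ΣWhere-atMostOne _ (x ∘ edge p) j λ j′ →
             ι-injective ∘ inSet-label′ p j′ (ι j)) ⟩
      Σℚ (λ (p : Fin len) → if inSet (label′ p j) (ι j) then x (edge p j) else 0ℚ)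
        ≡⟨ Σℚ-cong (λ p → trans (inSet-label′-ι p j _)
             (cong (λ v → if toℕ p <ᵇ budget (ι j) then v else 0ℚ) (x≡y p))) ⟩
      Σℚ (λ (p : Fin len) → if toℕ p <ᵇ budget (ι j) then y else 0ℚ)
        ≡⟨ Σℚ-prefix (budget (ι j)) y (budget≤len j) ⟩
      ℕ→ℚ (budget (ι j)) * y ∎
      where
      open ≡-Reasoning
      ι-injective : ∀ {a b} → ι a ≡ ι b → a ≡ b
      ι-injective = Fin.inject≤-injective k≤Tn k≤Tn _ _

    load-unused : ∀ x t → (∀ j → ι j ≢ t) → load x t ≡ 0ℚ
    load-unused x t ι≢t = ΣWhere-false _ x λ e →
      ¬-not (ι≢t (proj₂ (remQuot k e)) ∘ inSet-label′ (proj₁ (remQuot k e)) (proj₂ (remQuot k e)) t)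

    load-uniform : ∀ x y → 0ℚ ≤ y → (∀ e → x e ≡ y) → ∀ t → load x t ≤ y * ℕ→ℚ (budget t)
    load-uniform x y 0≤y x≡y t with Fin.any? (λ j → ι j Fin.≟ t)
    ... | yes (j , refl) =
      ≤-reflexive (trans (load-ι x y j (λ p → x≡y (edge p j))) (*-comm (ℕ→ℚ (budget (ι j))) y))
    ... | no ∄j = begin
      load x t                ≡⟨ load-unused x t (λ j ιj≡t → ∄j (j , ιj≡t)) ⟩
      0ℚ                      ≡⟨ *-zeroˡ (ℕ→ℚ (budget t)) ⟨
      0ℚ * ℕ→ℚ (budget t)     ≤⟨ *-monoʳ-≤-nonNeg (ℕ→ℚ (budget t)) {{budget-nonNeg}} 0≤y ⟩
      y * ℕ→ℚ (budget t)      ∎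
      where
      open ≤-Reasoning
      budget-nonNeg : ℚ.NonNegative (ℕ→ℚ (budget t))
      budget-nonNeg = pos⇒nonNeg (ℕ→ℚ (budget t)) {{budget-positive t}}

    integral-flow⇒1≤z : ∀ x z → Integral x → Σℚ (x ∘ edge zero) ≡ 1ℚ →
      (∀ q j → x (edge (suc q) j) ≡ x (edge (inject₁ q) j)) →
      (∀ t → load x t ≤ z * ℕ→ℚ (budget t)) → 1ℚ ≤ z
    integral-flow⇒1≤z x z integral Σ≡1 conserved within-budget
      with j , saturated ← integral-flow-saturates-path x integral Σ≡1 conserved =
      *-cancelʳ-≤-pos (ℕ→ℚ (budget (ι j))) {{budget-positive (ι j)}} (begin
        1ℚ * ℕ→ℚ (budget (ι j))   ≡⟨ *-comm 1ℚ (ℕ→ℚ (budget (ι j))) ⟩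
        ℕ→ℚ (budget (ι j)) * 1ℚ   ≡⟨ load-ι x 1ℚ j saturated ⟨
        load x (ι j)              ≤⟨ within-budget (ι j) ⟩
        z * ℕ→ℚ (budget (ι j))    ∎)
      where open ≤-Reasoning

  instance
    k-positive : Positive (ℕ→ℚ k)
    k-positive = ℕ→ℚ-positive k

    k-nonZero : ℚ.NonZero (ℕ→ℚ k)
    k-nonZero = pos⇒nonZero (ℕ→ℚ k)

  1/k : ℚ
  1/k = 1/ ℕ→ℚ k

  k*1/k≡1 : ℕ→ℚ k * 1/k ≡ 1ℚ
  k*1/k≡1 = *-inverseʳ (ℕ→ℚ k)

  0<1/k : 0ℚ < 1/k
  0<1/k = positive⁻¹ 1/k {{1/pos⇒pos (ℕ→ℚ k)}}

  0≤1/k : 0ℚ ≤ 1/k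
  0≤1/k = <⇒≤ 0<1/k

  1/k≤1 : 1/k ≤ 1ℚ
  1/k≤1 = begin
    1/k               ≡⟨ *-identityˡ 1/k ⟨
    1ℚ * 1/k          ≤⟨ *-monoʳ-≤-nonNeg 1/k {{ℚ.nonNegative 0≤1/k}} (ℕ→ℚ-mono-≤ (ℕ.>-nonZero⁻¹ k)) ⟩
    ℕ→ℚ k * 1/k       ≡⟨ k*1/k≡1 ⟩
    1ℚ                ∎
    where open ≤-Reasoning

  GapAtLeast-k : ∀ {N} {Feasible : (Fin N → ℚ) → ℚ → Set} xf → Feasible xf 1/k →
    (∀ x z → Integral x → Feasible x z → 1ℚ ≤ z) → GapAtLeast Feasible (ℕ→ℚ k)
  GapAtLeast-k xf xf-feasible integral-1≤z = xf , 1/k , xf-feasible , 0<1/k , λ x z integral feasible →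
    subst (_≤ z) (sym k*1/k≡1) (integral-1≤z x z integral feasible)

  tailVertex headVertex : Maybe (Fin W) → Fin (suc (suc W))
  tailVertex nothing  = zero
  tailVertex (just w) = suc (suc w)
  headVertex nothing  = suc zero
  headVertex (just w) = suc (suc w)

  tailVertex-injective : Injective _≡_ _≡_ tailVertex
  tailVertex-injective {nothing} {nothing} _    = refl
  tailVertex-injective {just _}  {just _}  refl = refl

  headVertex-injective : Injective _≡_ _≡_ headVertex
  headVertex-injective {nothing} {nothing} _    = refl
  headVertex-injective {just _}  {just _}  refl = refl

  tailVertex≡headVertex⇒ : ∀ a b → tailVertex a ≡ headVertex b → ∃ λ w → a ≡ just w × b ≡ just w
  tailVertex≡headVertex⇒ nothing  nothing   ()
  tailVertex≡headVertex⇒ nothing  (just _)  ()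
  tailVertex≡headVertex⇒ (just w) (just .w) refl = w , refl , refl

  module TailFlow = Flow tailVertex-injective
  module HeadFlow = Flow headVertex-injective

  path-loopless : ∀ e → tailVertex (tail e) ≢ headVertex (head e)
  path-loopless e eq with w , tail≡w , head≡w ← tailVertex≡headVertex⇒ (tail e) (head e) eq =
    no-loop e w tail≡w head≡w

  module PathLP (k≤T : k ℕ.≤ T n) (2^k≤len : 2 ^ k ℕ.≤ len) where
    open Labelling k≤T 2^k≤len

    pathInstance : PathInstance n
    pathInstance = record
      { nV       = suc (suc W)
      ; src      = tailVertex ∘ tail
      ; tgt      = headVertex ∘ head
      ; s        = zero
      ; t        = suc zero
      ; s≢t      = λ ()
      ; loopless = path-loopless
      ; simple   = λ e e′ src≡ tgt≡ →
          endpoints-injective e e′ (tailVertex-injective src≡) (headVertex-injective tgt≡)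
      ; S        = label
      }

    path-fractional : PathFeasible pathInstance (λ _ → 1/k) 1/k
    path-fractional =
        (λ _ → 0≤1/k , 1/k≤1)
      , conservation
      , trans (TailFlow.outflow-s (λ _ → 1/k)) unit-flow
      , trans (HeadFlow.inflow-t (λ _ → 1/k)) unit-flow
      , load-uniform (λ _ → 1/k) 1/k 0≤1/k (λ _ → refl)
      where
      unit-flow : Σℚ {k} (λ _ → 1/k) ≡ 1ℚ
      unit-flow = trans (Σℚ-const k 1/k) k*1/k≡1
      balanced : ∀ w → ΣWhere (λ e → tailVertex (tail e) == suc (suc w)) (λ _ → 1/k)
                     ≡ ΣWhere (λ e → headVertex (head e) == suc (suc w)) (λ _ → 1/k)
      balanced = inner-elim λ q j →
        trans (TailFlow.outflow-inner (λ _ → 1/k) q j) (sym (HeadFlow.inflow-inner (λ _ → 1/k) q j))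
      conservation : ∀ i → i ≢ zero → i ≢ suc zero →
        ΣWhere (λ e → tailVertex (tail e) == i) (λ _ → 1/k)
          ≡ ΣWhere (λ e → headVertex (head e) == i) (λ _ → 1/k)
      conservation zero          i≢s _   = contradiction refl i≢s
      conservation (suc zero)    _   i≢t = contradiction refl i≢t
      conservation (suc (suc w)) _   _   = balanced w

    path-integral : ∀ x z → Integral x → PathFeasible pathInstance x z → 1ℚ ≤ z
    path-integral x z integral (_ , conservation , source , _ , within-budget) =
      integral-flow⇒1≤z x z integral (trans (sym (TailFlow.outflow-s x)) source) conserved within-budget
      where
      conserved : ∀ q j → x (edge (suc q) j) ≡ x (edge (inject₁ q) j)
      conserved q j = begin
        x (edge (suc q) j)                                                     ≡⟨ TailFlow.outflow-inner x q j ⟨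
        ΣWhere (λ e → tailVertex (tail e) == suc (suc (inner q j))) x          ≡⟨ conservation _ (λ ()) (λ ()) ⟩
        ΣWhere (λ e → headVertex (head e) == suc (suc (inner q j))) x          ≡⟨ HeadFlow.inflow-inner x q j ⟩
        x (edge (inject₁ q) j)                                                 ∎
        where open ≡-Reasoning

    path-gap : GapAtLeast (PathFeasible pathInstance) (ℕ→ℚ k)
    path-gap = GapAtLeast-k (λ _ → 1/k) path-fractional path-integral

  -- The matching graph splits every inner vertex w into copies suc w on both
  -- sides, joined by the idle edge n ↑ʳ w; left zero plays s and right zero t.
  pmVertex : Maybe (Fin W) → Fin (suc W)
  pmVertex nothing  = zero
  pmVertex (just w) = suc w

  pmVertex-injective : Injective _≡_ _≡_ pmVertex
  pmVertex-injective {nothing} {nothing} _    = refl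
  pmVertex-injective {just _}  {just _}  refl = refl

  module PMFlow = Flow pmVertex-injective

  left right : Fin (n ℕ.+ W) → Fin (suc W)
  left  = [ pmVertex ∘ tail , suc ]′ ∘ splitAt n
  right = [ pmVertex ∘ head , suc ]′ ∘ splitAt n

  pm-simple : ∀ e e′ → left e ≡ left e′ → right e ≡ right e′ → e ≡ e′
  pm-simple e e′ l≡ r≡ with splitAt n e in eq | splitAt n e′ in eq′
  ... | inj₁ a | inj₁ a′ = trans (sym (Fin.splitAt⁻¹-↑ˡ eq))
    (trans (cong (_↑ˡ W) (endpoints-injective a a′ (pmVertex-injective l≡) (pmVertex-injective r≡)))
           (Fin.splitAt⁻¹-↑ˡ eq′))
  ... | inj₂ w | inj₂ w′ = trans (sym (Fin.splitAt⁻¹-↑ʳ eq))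
    (trans (cong (n ↑ʳ_) (Fin.suc-injective l≡)) (Fin.splitAt⁻¹-↑ʳ eq′))
  ... | inj₁ a | inj₂ w′ = contradiction (pmVertex-injective r≡) (no-loop a w′ (pmVertex-injective l≡))
  ... | inj₂ w | inj₁ a′ =
    contradiction (pmVertex-injective (sym r≡)) (no-loop a′ w (pmVertex-injective (sym l≡)))

  idle-sum : ∀ (y : Fin W → ℚ) w → ΣWhere (λ w′ → suc w′ == suc w) y ≡ y w
  idle-sum y w = ΣWhere-unique _ y w (λ w′ → Fin.suc-injective ∘ ==⇒≡) (==-refl (suc w))

  left-s : ∀ x → ΣWhere (λ e → left e == zero) x ≡ Σℚ (λ j → x (edge zero j ↑ˡ W))
  left-s x = begin
    ΣWhere (λ e → left e == zero) x
      ≡⟨ ΣWhere-splitAt n W (λ r → [ pmVertex ∘ tail , suc ]′ r == zero) x ⟩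
    ΣWhere (λ e → pmVertex (tail e) == zero) (x ∘ (_↑ˡ W)) + ΣWhere (λ w → suc w == zero) (x ∘ (n ↑ʳ_))
      ≡⟨ cong₂ _+_ (PMFlow.outflow-s (x ∘ (_↑ˡ W))) (ΣWhere-false _ (x ∘ (n ↑ʳ_)) (λ _ → refl)) ⟩
    Σℚ (λ j → x (edge zero j ↑ˡ W)) + 0ℚ
      ≡⟨ +-identityʳ _ ⟩
    Σℚ (λ j → x (edge zero j ↑ˡ W)) ∎
    where open ≡-Reasoning

  right-t : ∀ x → ΣWhere (λ e → right e == zero) x ≡ Σℚ (λ j → x (edge last j ↑ˡ W))
  right-t x = begin
    ΣWhere (λ e → right e == zero) x
      ≡⟨ ΣWhere-splitAt n W (λ r → [ pmVertex ∘ head , suc ]′ r == zero) x ⟩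
    ΣWhere (λ e → pmVertex (head e) == zero) (x ∘ (_↑ˡ W)) + ΣWhere (λ w → suc w == zero) (x ∘ (n ↑ʳ_))
      ≡⟨ cong₂ _+_ (PMFlow.inflow-t (x ∘ (_↑ˡ W))) (ΣWhere-false _ (x ∘ (n ↑ʳ_)) (λ _ → refl)) ⟩
    Σℚ (λ j → x (edge last j ↑ˡ W)) + 0ℚ
      ≡⟨ +-identityʳ _ ⟩
    Σℚ (λ j → x (edge last j ↑ˡ W)) ∎
    where open ≡-Reasoning

  left-inner : ∀ x q j →
    ΣWhere (λ e → left e == suc (inner q j)) x ≡ x (edge (suc q) j ↑ˡ W) + x (n ↑ʳ inner q j)
  left-inner x q j = trans (ΣWhere-splitAt n W (λ r → [ pmVertex ∘ tail , suc ]′ r == suc (inner q j)) x)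
    (cong₂ _+_ (PMFlow.outflow-inner (x ∘ (_↑ˡ W)) q j) (idle-sum (x ∘ (n ↑ʳ_)) (inner q j)))

  right-inner : ∀ x q j →
    ΣWhere (λ e → right e == suc (inner q j)) x ≡ x (edge (inject₁ q) j ↑ˡ W) + x (n ↑ʳ inner q j)
  right-inner x q j = trans (ΣWhere-splitAt n W (λ r → [ pmVertex ∘ head , suc ]′ r == suc (inner q j)) x)
    (cong₂ _+_ (PMFlow.inflow-inner (x ∘ (_↑ˡ W)) q j) (idle-sum (x ∘ (n ↑ʳ_)) (inner q j)))

  module PerfectMatchingLP (k≤T : k ℕ.≤ T (n ℕ.+ W)) (2^k≤len : 2 ^ k ℕ.≤ len) where
    open Labelling k≤T 2^k≤len

    pmLabel : Fin (n ℕ.+ W) → Maybe (Fin (T (n ℕ.+ W)))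
    pmLabel = [ label , const nothing ]′ ∘ splitAt n

    pmInstance : PMInstance (n ℕ.+ W)
    pmInstance = record
      { m      = suc W
      ; left   = left
      ; right  = right
      ; simple = pm-simple
      ; S      = pmLabel
      }

    pm-load : ∀ x t → ΣWhere (λ e → inSet (pmLabel e) t) x ≡ load (x ∘ (_↑ˡ W)) t
    pm-load x t = trans (ΣWhere-splitAt n W (λ r → inSet ([ label , const nothing ]′ r) t) x)
      (trans (cong (load (x ∘ (_↑ˡ W)) t +_) (ΣWhere-false _ (x ∘ (n ↑ʳ_)) (λ _ → refl)))
             (+-identityʳ _))

    xf : Fin (n ℕ.+ W) → ℚ
    xf = [ const 1/k , const (1ℚ ℚ.- 1/k) ]′ ∘ splitAt n

    xf-path : ∀ e → xf (e ↑ˡ W) ≡ 1/k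
    xf-path e = cong [ const 1/k , const (1ℚ ℚ.- 1/k) ]′ (Fin.splitAt-↑ˡ n e W)

    xf-idle : ∀ w → xf (n ↑ʳ w) ≡ 1ℚ ℚ.- 1/k
    xf-idle w = cong [ const 1/k , const (1ℚ ℚ.- 1/k) ]′ (Fin.splitAt-↑ʳ n W w)

    pm-fractional : PMFeasible pmInstance xf 1/k
    pm-fractional =
        bounds
      , covered right last inject₁ (right-t xf) (right-inner xf)
      , covered left zero suc (left-s xf) (left-inner xf)
      , λ t → subst (_≤ 1/k * ℕ→ℚ (budget t)) (sym (pm-load xf t))
                    (load-uniform (xf ∘ (_↑ˡ W)) 1/k 0≤1/k xf-path t)
      where
      bounds : ∀ e → (0ℚ ≤ xf e) × (xf e ≤ 1ℚ)
      bounds e with splitAt n e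
      ... | inj₁ _ = 0≤1/k , 1/k≤1
      ... | inj₂ _ = 0≤1-p 1/k≤1 , 1-p≤1 0≤1/k
      unit-flow : ∀ p → Σℚ (λ j → xf (edge p j ↑ˡ W)) ≡ 1ℚ
      unit-flow p = trans (Σℚ-cong (λ j → xf-path (edge p j))) (trans (Σℚ-const k 1/k) k*1/k≡1)
      covered : ∀ (side : Fin (n ℕ.+ W) → Fin (suc W)) p₀ (p : Fin (suc m) → Fin len) →
        ΣWhere (λ e → side e == zero) xf ≡ Σℚ (λ j → xf (edge p₀ j ↑ˡ W)) →
        (∀ q j → ΣWhere (λ e → side e == suc (inner q j)) xf
                   ≡ xf (edge (p q) j ↑ˡ W) + xf (n ↑ʳ inner q j)) →
        ∀ v → ΣWhere (λ e → side e == v) xf ≡ 1ℚ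
      covered side p₀ p at-zero at-inner zero    = trans at-zero (unit-flow p₀)
      covered side p₀ p at-zero at-inner (suc w) =
        inner-elim {P = λ w → ΣWhere (λ e → side e == suc w) xf ≡ 1ℚ} (λ q j →
          trans (at-inner q j) (trans (cong₂ _+_ (xf-path _) (xf-idle _)) (p+[1-p]≡1 1/k))) w

    pm-integral : ∀ x z → Integral x → PMFeasible pmInstance x z → 1ℚ ≤ z
    pm-integral x z integral (_ , right≡1 , left≡1 , within-budget) =
      integral-flow⇒1≤z (x ∘ (_↑ˡ W)) z (integral ∘ (_↑ˡ W))
        (trans (sym (left-s x)) (left≡1 zero)) conserved
        (λ t → subst (_≤ z * ℕ→ℚ (budget t)) (pm-load x t) (within-budget t))
      where
      conserved : ∀ q j → x (edge (suc q) j ↑ˡ W) ≡ x (edge (inject₁ q) j ↑ˡ W)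
      conserved q j = ∙-cancelʳ (x (n ↑ʳ inner q j)) _ _ (begin
        x (edge (suc q) j ↑ˡ W) + x (n ↑ʳ inner q j)       ≡⟨ left-inner x q j ⟨
        ΣWhere (λ e → left e == suc (inner q j)) x         ≡⟨ left≡1 _ ⟩
        1ℚ                                                 ≡⟨ right≡1 _ ⟨
        ΣWhere (λ e → right e == suc (inner q j)) x        ≡⟨ right-inner x q j ⟩
        x (edge (inject₁ q) j ↑ˡ W) + x (n ↑ʳ inner q j)   ∎)
        where open ≡-Reasoning

    pm-gap : GapAtLeast (PMFeasible pmInstance) (ℕ→ℚ k)
    pm-gap = GapAtLeast-k xf pm-fractional pm-integral

module LargeInstance (N : ℕ) where
  open RationalFacts using (¼; ¼*-≤)
  open IntegralityGap using (GapAtLeast-mono)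
  open import Data.Nat using (zero; suc; _^_; _+_; _*_; _≤_; _<_; z≤n; s≤s)
  open import Data.Nat.Properties
  open import Data.Nat.Logarithm
    using (⌊log₂_⌋; ⌈log₂_⌉; ⌊log₂⌋-mono-≤; ⌈log₂⌉-mono-≤; ⌊log₂[2^n]⌋≡n; ⌈log₂2^n⌉≡n)
  import Data.Rational as ℚ
  open import Relation.Binary.PropositionalEquality

  n<2^n : ∀ n → n < 2 ^ n
  n<2^n zero    = s≤s z≤n
  n<2^n (suc n) =
    ≤-trans (+-mono-≤ (m^n>0 2 n) (n<2^n n)) (≤-reflexive (cong (2 ^ n +_) (sym (+-identityʳ (2 ^ n)))))

  k : ℕ
  k = suc N

  open ParallelPaths k (2 ^ k) public

  2^k≤len : 2 ^ k ≤ len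
  2^k≤len = m≤n+m (2 ^ k) 2

  k≤⌈log₂n⌉ : k ≤ ⌈log₂ n ⌉
  k≤⌈log₂n⌉ = subst (_≤ ⌈log₂ n ⌉) (⌈log₂2^n⌉≡n k) (⌈log₂⌉-mono-≤ (≤-trans 2^k≤len (m≤m*n len k)))

  n≤n+W : n ≤ n + W
  n≤n+W = m≤m+n n W

  N≤n : N ≤ n
  N≤n = ≤-trans (n≤1+n N) (m≤n*m k len)

  N≤n+W : N ≤ n + W
  N≤n+W = ≤-trans N≤n n≤n+W

  n+W≤2^[4k] : n + W ≤ 2 ^ (4 * k)
  n+W≤2^[4k] = begin
    n + W                ≤⟨ +-monoʳ-≤ n (*-monoˡ-≤ k (n≤1+n (suc (2 ^ k)))) ⟩
    n + n                ≡⟨ cong (n +_) (+-identityʳ n) ⟨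
    2 * n                ≤⟨ *-monoˡ-≤ n 2≤B ⟩
    B * n                ≤⟨ *-monoʳ-≤ B (*-mono-≤ len≤B*B (<⇒≤ (n<2^n k))) ⟩
    B * ((B * B) * B)    ≡⟨ cong (B *_) (*-assoc B B B) ⟩
    B * (B * (B * B))    ≡⟨ cong (λ b → B * (B * (B * b))) (*-identityʳ B) ⟨
    B ^ 4                ≡⟨ ^-*-assoc 2 k 4 ⟩
    2 ^ (k * 4)          ≡⟨ cong (2 ^_) (*-comm k 4) ⟩
    2 ^ (4 * k)          ∎
    where
    open ≤-Reasoning
    B : ℕ
    B = 2 ^ k
    2≤B : 2 ≤ B
    2≤B = *-monoʳ-≤ 2 (m^n>0 2 N)
    len≤B*B : len ≤ B * B
    len≤B*B = begin
      2 + B      ≤⟨ +-monoˡ-≤ B 2≤B ⟩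
      B + B      ≡⟨ cong (B +_) (+-identityʳ B) ⟨
      2 * B      ≤⟨ *-monoˡ-≤ B 2≤B ⟩
      B * B      ∎

  ⌊log₂⌋≤4k : ∀ {x} → x ≤ n + W → ⌊log₂ x ⌋ ≤ 4 * k
  ⌊log₂⌋≤4k {x} x≤n+W =
    subst (⌊log₂ x ⌋ ≤_) (⌊log₂[2^n]⌋≡n (4 * k)) (⌊log₂⌋-mono-≤ (≤-trans x≤n+W n+W≤2^[4k]))

  open PathLP k≤⌈log₂n⌉ 2^k≤len public using (pathInstance; path-gap)
  open PerfectMatchingLP (≤-trans k≤⌈log₂n⌉ (⌈log₂⌉-mono-≤ n≤n+W)) 2^k≤len
    public using (pmInstance; pm-gap)

  path-gap-log : GapAtLeast (PathFeasible pathInstance) (¼ ℚ.* ℕ→ℚ ⌊log₂ n ⌋)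
  path-gap-log = GapAtLeast-mono (¼*-≤ {n = k} (⌊log₂⌋≤4k n≤n+W)) path-gap

  pm-gap-log : GapAtLeast (PMFeasible pmInstance) (¼ ℚ.* ℕ→ℚ ⌊log₂ (n + W) ⌋)
  pm-gap-log = GapAtLeast-mono (¼*-≤ {n = k} (⌊log₂⌋≤4k ≤-refl)) pm-gap

open import Data.Nat using (ℕ; _≤_; _+_)
open import Data.Nat.Logarithm using (⌊log₂_⌋)
open import Data.Product using (_×_; Σ; _,_)
open import Data.Rational using (ℚ; 0ℚ; _<_; _*_)
open RationalFacts using (¼; 0<¼)

theorem7p2 : (Σ ℚ λ c → (0ℚ < c) × ((N : ℕ) → Σ ℕ λ n → (N ≤ n) ×
    Σ (PathInstance n) λ I →
    GapAtLeast (PathFeasible I) (c * ℕ→ℚ ⌊log₂ n ⌋)))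
    × (Σ ℚ λ c → (0ℚ < c) × ((N : ℕ) → Σ ℕ λ n → (N ≤ n) ×
    Σ (PMInstance n) λ I →
    GapAtLeast (PMFeasible I) (c * ℕ→ℚ ⌊log₂ n ⌋)))
theorem7p2 =
    (¼ , 0<¼ , λ N → let open LargeInstance N in n , N≤n , pathInstance , path-gap-log)
  , (¼ , 0<¼ , λ N → let open LargeInstance N in n + W , N≤n+W , pmInstance , pm-gap-log)
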